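{- The following two statements are equivalent. (A) For every finite union-closed family $\mathcal{F}$ with $\mathcal{F}\notin\{\emptyset,\{\emptyset\}\}$: if $\mathcal{F}$ is not a power set (i.e. $\mathcal{F}\neq\mathcal{P}(U(\mathcal{F}))$), then there is $a\in U(\mathcal{F})$ with $|\mathcal{F}_a|>\frac{|\mathcal{F}|}{2}$. (B) For every finite union-closed family $\mathcal{F}$ with $U(\mathcal{F})\neq\emptyset$: if $\max_{a\in U(\mathcal{F})}|\mathcal{F}_a|=\frac{|\mathcal{F}|}{2}$, then $\mathcal{F}=\mathcal{P}(U(\mathcal{F}))$.
   Context: The universe $U(\mathcal{F})$ of a family $\mathcal{F}$ of sets is the union of its members. $\mathcal{F}$ is union-closed if $F\cup G\in\mathcal{F}$ for all $F,G\in\mathcal{F}$. For $a\in U(\mathcal{F})$, $\mathcal{F}_a=\{F\in\mathcal{F}: a\in F\}$. $\mathcal{P}(X)$ is the power set of $X$. -}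

module Defs where

open import Data.Bool using (Bool; true; false)
open import Data.Nat using (ℕ; zero; suc; _*_; _<_; _⊔_)
open import Data.List using (List; []; _∷_; _++_; map; length; filterᵇ; foldr)
open import Data.Fin using (Fin)
open import Data.Fin.Subset using (Subset; inside; outside; _∪_; _∈_; _⊆_; ⊥)
open import Data.Fin.Subset.Properties using (_∈?_)
open import Data.Vec using ([]; _∷_)
open import Data.List using (filter)
open import Data.List.Base using (allFin)
open import Data.Product using (Σ; _×_; ∃)
open import Relation.Nullary using (¬_; does)
open import Relation.Binary.PropositionalEquality using (_≡_; _≢_)

-- A family of subsets of the ground set Fin n, given by its
-- (decidable) characteristic function.  Every such family is finite.
Family : ℕ → Set
Family n = Subset n → Bool

-- Enumeration of all 2^n subsets of Fin n (each exactly once).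
allSubsets : (n : ℕ) → List (Subset n)
allSubsets zero    = [] ∷ []
allSubsets (suc n) = map (outside ∷_) (allSubsets n) ++ map (inside ∷_) (allSubsets n)

members : ∀ {n} → Family n → List (Subset n)
members {n} F = filterᵇ F (allSubsets n)

card : ∀ {n} → Family n → ℕ
card F = length (members F)

U : ∀ {n} → Family n → Subset n
U F = foldr _∪_ ⊥ (members F)

deg : ∀ {n} → Family n → Fin n → ℕ
deg F a = length (filter (a ∈?_) (members F))

-- max_{a ∈ U(F)} |F_a|   (0 if U(F) is empty)
maxDeg : ∀ {n} → Family n → ℕ
maxDeg {n} F = foldr _⊔_ 0 (map (deg F) (filter (_∈? U F) (allFin n)))

Mem : ∀ {n} → Subset n → Family n → Set
Mem S F = F S ≡ true

UnionClosed : ∀ {n} → Family n → Set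
UnionClosed F = ∀ S T → Mem S F → Mem T F → Mem (S ∪ T) F

IsEmptyFamily : ∀ {n} → Family n → Set
IsEmptyFamily F = ∀ S → ¬ Mem S F

IsOnlyEmptySet : ∀ {n} → Family n → Set
IsOnlyEmptySet F = ∀ S → (Mem S F → S ≡ ⊥) × (S ≡ ⊥ → Mem S F)

IsPowerSetOfUniverse : ∀ {n} → Family n → Set
IsPowerSetOfUniverse F = ∀ S → (Mem S F → S ⊆ U F) × (S ⊆ U F → Mem S F)

StatementA : Set
StatementA = ∀ n (F : Family n) → UnionClosed F →
  ¬ IsEmptyFamily F → ¬ IsOnlyEmptySet F →
  ¬ IsPowerSetOfUniverse F →
  Σ (Fin n) λ a → a ∈ U F × card F < 2 * deg F a

StatementB : Set
StatementB = ∀ n (F : Family n) → UnionClosed F →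
  U F ≢ ⊥ →
  2 * maxDeg F ≡ card F →
  IsPowerSetOfUniverse F

-- (A) ⇒ (B): a member S ⊆ U(F) missing from F makes F not a power set, so (A)
-- yields an element of degree above |F|/2, contradicting max degree = |F|/2.
--
-- (B) ⇒ (A): suppose every a ∈ U(F) has degree at most |F|/2 and F has some
-- member. Adjoin a fresh element 0 freely, G = {S, S ∪ {0} : S ∈ F}. Then
-- |G| = 2|F|, the degree of 0 in G is |F| and every other degree doubles, so the
-- maximum degree of G is exactly |G|/2. By (B), G is the power set of U(G), and
-- hence F is the power set of U(F) — contradicting the hypothesis of (A). So F
-- has no member at all, contradicting F ≠ ∅.
module Submission where

open import Defs
open import Data.Bool using (true; false)
open import Data.Bool.Properties using (T-≡; not-¬)
open import Data.Empty using (⊥-elim)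
open import Data.Fin using (Fin; zero; suc)
open import Data.Fin.Subset using (Subset; inside; outside; _∈_; _⊆_; ⊥; ⋃)
open import Data.Fin.Subset.Properties using (_∈?_; x∈p∪q⁻; x∈p∪q⁺; ∉⊥; Empty-unique)
open import Data.List using (List; []; _∷_; _++_; map; length; filter; filterᵇ; foldr; allFin)
open import Data.List.Properties using (filter-++; length-++; length-map; foldr-preservesᵒ)
open import Data.List.Membership.Propositional using (find; lose) renaming (_∈_ to _∈ₗ_)
open import Data.List.Membership.Propositional.Properties
  using (∈-map⁺; ∈-++⁺ˡ; ∈-++⁺ʳ; ∈-filter⁺; ∈-filter⁻; ∈-allFin)
open import Data.List.Relation.Unary.Any using (Any; here; there; any?; satisfied)
open import Data.Nat using (ℕ; suc; _+_; _*_; _≤_; _⊔_; _<?_; z≤n)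
open import Data.Nat.Properties
  using (⊔-lub; ≤-refl; m≤n⇒m≤n⊔o; m≤n⇒m≤o⊔n; ≤-reflexive; ≤-antisym; ≮⇒≥; <⇒≱; *-monoʳ-≤; +-identityʳ)
open import Data.Product using (∃; _×_; _,_; proj₁; proj₂)
open import Data.Sum using (_⊎_; inj₁; inj₂)
open import Data.Vec using ([]; _∷_)
import Data.Vec.Base as Vec
open import Function using (_∘_)
open import Function.Bundles using (module Equivalence)
open import Relation.Nullary using (¬_; yes; no)
open import Relation.Nullary.Decidable using (_×-dec_; T?)
open import Relation.Binary.PropositionalEquality
  using (_≡_; refl; sym; trans; cong; cong₂; subst; module ≡-Reasoning)

private
  variable
    n : ℕ

∈-allSubsets : (S : Subset n) → S ∈ₗ allSubsets n
∈-allSubsets []            = here refl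
∈-allSubsets (outside ∷ S) = ∈-++⁺ˡ (∈-map⁺ (outside ∷_) (∈-allSubsets S))
∈-allSubsets {suc n} (inside ∷ S) =
  ∈-++⁺ʳ (map (outside ∷_) (allSubsets n)) (∈-map⁺ (inside ∷_) (∈-allSubsets S))

Mem⇒∈-members : {F : Family n} {S : Subset n} → Mem S F → S ∈ₗ members F
Mem⇒∈-members {F = F} {S} S∈F =
  ∈-filter⁺ (λ T → T? (F T)) (∈-allSubsets S) (Equivalence.from T-≡ S∈F)

∈-members⇒Mem : {F : Family n} {S : Subset n} → S ∈ₗ members F → Mem S F
∈-members⇒Mem {n} {F} S∈ms =
  Equivalence.to T-≡ (proj₂ (∈-filter⁻ (λ T → T? (F T)) {xs = allSubsets n} S∈ms))

∈⋃⁺ : {x : Fin n} (ps : List (Subset n)) → Any (x ∈_) ps → x ∈ ⋃ ps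
∈⋃⁺ ps x∈some = foldr-preservesᵒ (λ _ _ → x∈p∪q⁺) ⊥ ps (inj₂ x∈some)

∈⋃⁻ : {x : Fin n} (ps : List (Subset n)) → x ∈ ⋃ ps → Any (x ∈_) ps
∈⋃⁻ []       x∈⊥ = ⊥-elim (∉⊥ x∈⊥)
∈⋃⁻ (p ∷ ps) x∈⋃ with x∈p∪q⁻ p (⋃ ps) x∈⋃
... | inj₁ x∈p = here x∈p
... | inj₂ x∈⋃ps = there (∈⋃⁻ ps x∈⋃ps)

member⊆U : {F : Family n} {S : Subset n} → Mem S F → S ⊆ U F
member⊆U {F = F} S∈F x∈S = ∈⋃⁺ (members F) (lose (Mem⇒∈-members {F = F} S∈F) x∈S)

∈U⇒∃member : {F : Family n} {x : Fin n} → x ∈ U F → ∃ λ S → Mem S F × x ∈ S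
∈U⇒∃member {F = F} x∈U with find (∈⋃⁻ (members F) x∈U)
... | S , S∈ms , x∈S = S , ∈-members⇒Mem {F = F} S∈ms , x∈S

U≡⊥ : {F : Family n} → (∀ S → Mem S F → S ≡ ⊥) → U F ≡ ⊥
U≡⊥ {F = F} allEmpty = Empty-unique λ (x , x∈U) →
  let S , S∈F , x∈S = ∈U⇒∃member {F = F} x∈U
  in ∉⊥ (subst (x ∈_) (allEmpty S S∈F) x∈S)

≤-foldr-⊔ : {x : ℕ} (xs : List ℕ) → x ∈ₗ xs → x ≤ foldr _⊔_ 0 xs
≤-foldr-⊔ xs x∈xs =
  foldr-preservesᵒ join-≤ 0 xs (inj₂ (lose x∈xs ≤-refl))
  where
  join-≤ : ∀ {x} a b → x ≤ a ⊎ x ≤ b → x ≤ a ⊔ b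
  join-≤ a b (inj₁ x≤a) = m≤n⇒m≤n⊔o b x≤a
  join-≤ a b (inj₂ x≤b) = m≤n⇒m≤o⊔n a x≤b

foldr-⊔-≤ : {A : Set} (f : A → ℕ) {m : ℕ} (xs : List A) →
            (∀ x → x ∈ₗ xs → f x ≤ m) → foldr _⊔_ 0 (map f xs) ≤ m
foldr-⊔-≤ f []       _     = z≤n
foldr-⊔-≤ f (x ∷ xs) bound = ⊔-lub (bound x (here refl)) (foldr-⊔-≤ f xs (λ y → bound y ∘ there))

deg≤maxDeg : (F : Family n) {a : Fin n} → a ∈ U F → deg F a ≤ maxDeg F
deg≤maxDeg F {a} a∈U =
  ≤-foldr-⊔ _ (∈-map⁺ (deg F) (∈-filter⁺ (_∈? U F) (∈-allFin a) a∈U))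

maxDeg≤ : (F : Family n) {m : ℕ} → (∀ a → a ∈ U F → deg F a ≤ m) → maxDeg F ≤ m
maxDeg≤ {n} F bound = foldr-⊔-≤ (deg F) (filter (_∈? U F) (allFin n))
  λ a a∈us → bound a (proj₂ (∈-filter⁻ (_∈? U F) {xs = allFin n} a∈us))

A⇒B : StatementA → StatementB
A⇒B A n F closed U≢⊥ 2maxDeg≡card S = member⊆U , complete
  where
  notEmpty : ¬ IsEmptyFamily F
  notEmpty empty = U≢⊥ (U≡⊥ (λ S S∈F → ⊥-elim (empty S S∈F)))

  notOnlyEmptySet : ¬ IsOnlyEmptySet F
  notOnlyEmptySet only = U≢⊥ (U≡⊥ (λ S → proj₁ (only S)))

  complete : S ⊆ U F → Mem S F
  complete S⊆U with F S in S∈?F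
  ... | true  = refl
  ... | false
    with a , a∈U , card<2deg ← A n F closed notEmpty notOnlyEmptySet
           (λ power → not-¬ S∈?F (proj₂ (power S) S⊆U))
    = ⊥-elim (<⇒≱ card<2deg (subst (2 * deg F a ≤_) 2maxDeg≡card
                                    (*-monoʳ-≤ 2 (deg≤maxDeg F a∈U))))

withFreePoint : Family n → Family (suc n)
withFreePoint F (_ ∷ S) = F S

module _ (F : Family n) where

  private
    G = withFreePoint F

  filterᵇ-withFreePoint : ∀ b (Ss : List (Subset n)) →
                          filterᵇ G (map (b ∷_) Ss) ≡ map (b ∷_) (filterᵇ F Ss)
  filterᵇ-withFreePoint b []       = refl
  filterᵇ-withFreePoint b (S ∷ Ss) with F S
  ... | true  = cong ((b ∷ S) ∷_) (filterᵇ-withFreePoint b Ss)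
  ... | false = filterᵇ-withFreePoint b Ss

  members-withFreePoint : members G ≡ map (outside ∷_) (members F) ++ map (inside ∷_) (members F)
  members-withFreePoint =
    trans (filter-++ _ (map (outside ∷_) (allSubsets n)) _)
          (cong₂ _++_ (filterᵇ-withFreePoint outside (allSubsets n))
                      (filterᵇ-withFreePoint inside (allSubsets n)))

  card-withFreePoint : card G ≡ 2 * card F
  card-withFreePoint = begin
    length (members G)
      ≡⟨ cong length members-withFreePoint ⟩
    length (map (outside ∷_) (members F) ++ map (inside ∷_) (members F))
      ≡⟨ length-++ (map (outside ∷_) (members F)) ⟩
    length (map (outside ∷_) (members F)) + length (map (inside ∷_) (members F))
      ≡⟨ cong₂ _+_ (length-map _ (members F)) (length-map _ (members F)) ⟩
    card F + card F
      ≡⟨ cong (card F +_) (sym (+-identityʳ (card F))) ⟩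
    2 * card F ∎
    where open ≡-Reasoning

  deg-withFreePoint : ∀ x → deg G x ≡ length (filter (x ∈?_) (map (outside ∷_) (members F)))
                                     + length (filter (x ∈?_) (map (inside ∷_) (members F)))
  deg-withFreePoint x = begin
    length (filter (x ∈?_) (members G))
      ≡⟨ cong (length ∘ filter (x ∈?_)) members-withFreePoint ⟩
    length (filter (x ∈?_) (map (outside ∷_) (members F) ++ map (inside ∷_) (members F)))
      ≡⟨ cong length (filter-++ (x ∈?_) (map (outside ∷_) (members F)) _) ⟩
    length (filter (x ∈?_) (map (outside ∷_) (members F)) ++ filter (x ∈?_) (map (inside ∷_) (members F)))
      ≡⟨ length-++ (filter (x ∈?_) (map (outside ∷_) (members F))) ⟩
    _ ∎
    where open ≡-Reasoning

  deg-withFreePoint-zero : deg G zero ≡ card F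
  deg-withFreePoint-zero =
    trans (deg-withFreePoint zero) (cong₂ _+_ (cong length (none (members F))) (all (members F)))
    where
    none : (Ss : List (Subset n)) → filter (zero ∈?_) (map (outside ∷_) Ss) ≡ []
    none []       = refl
    none (_ ∷ Ss) = none Ss
    all : (Ss : List (Subset n)) → length (filter (zero ∈?_) (map (inside ∷_) Ss)) ≡ length Ss
    all []       = refl
    all (_ ∷ Ss) = cong suc (all Ss)

  deg-withFreePoint-suc : ∀ a → deg G (suc a) ≡ 2 * deg F a
  deg-withFreePoint-suc a =
    trans (deg-withFreePoint (suc a))
          (trans (cong₂ _+_ (count outside (members F)) (count inside (members F)))
                 (cong (deg F a +_) (sym (+-identityʳ (deg F a)))))
    where
    count : ∀ b (Ss : List (Subset n)) →
            length (filter (suc a ∈?_) (map (b ∷_) Ss)) ≡ length (filter (a ∈?_) Ss)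
    count b []       = refl
    count b (S ∷ Ss) with a ∈? S
    ... | yes _ = cong suc (count b Ss)
    ... | no  _ = count b Ss

  withFreePoint-unionClosed : UnionClosed F → UnionClosed G
  withFreePoint-unionClosed closed (_ ∷ S) (_ ∷ T) = closed S T

  zero∈U-withFreePoint : {T : Subset n} → Mem T F → zero ∈ U G
  zero∈U-withFreePoint {T} T∈F = member⊆U {F = G} {S = inside ∷ T} T∈F Vec.here

  suc∈U-withFreePoint⁺ : {a : Fin n} → a ∈ U F → suc a ∈ U G
  suc∈U-withFreePoint⁺ a∈U =
    let T , T∈F , a∈T = ∈U⇒∃member {F = F} a∈U
    in member⊆U {F = G} {S = inside ∷ T} T∈F (Vec.there a∈T)

  suc∈U-withFreePoint⁻ : {a : Fin n} → suc a ∈ U G → a ∈ U F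
  suc∈U-withFreePoint⁻ sa∈U with ∈U⇒∃member {F = G} sa∈U
  ... | _ ∷ T , T∈F , Vec.there a∈T = member⊆U {F = F} T∈F a∈T

  withFreePoint-powerSet : {T : Subset n} → Mem T F →
                           IsPowerSetOfUniverse G → IsPowerSetOfUniverse F
  withFreePoint-powerSet T∈F power S = member⊆U , λ S⊆U → proj₂ (power (inside ∷ S)) (∷⊆U S⊆U)
    where
    ∷⊆U : S ⊆ U F → (inside ∷ S) ⊆ U G
    ∷⊆U S⊆U Vec.here        = zero∈U-withFreePoint T∈F
    ∷⊆U S⊆U (Vec.there x∈S) = suc∈U-withFreePoint⁺ (S⊆U x∈S)

  withFreePoint-maxDeg : {T : Subset n} → Mem T F → (∀ a → a ∈ U F → 2 * deg F a ≤ card F) →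
                         2 * maxDeg G ≡ card G
  withFreePoint-maxDeg T∈F halfBounded =
    trans (cong (2 *_) (≤-antisym (maxDeg≤ G bounded) reached)) (sym card-withFreePoint)
    where
    bounded : ∀ x → x ∈ U G → deg G x ≤ card F
    bounded zero    _     = ≤-reflexive deg-withFreePoint-zero
    bounded (suc a) sa∈U  =
      subst (_≤ card F) (sym (deg-withFreePoint-suc a)) (halfBounded a (suc∈U-withFreePoint⁻ sa∈U))
    reached : card F ≤ maxDeg G
    reached = subst (_≤ maxDeg G) deg-withFreePoint-zero (deg≤maxDeg G (zero∈U-withFreePoint T∈F))

B⇒A : StatementB → StatementA
B⇒A B n F closed notEmpty _ notPower
  with any? (λ a → (a ∈? U F) ×-dec (card F <? 2 * deg F a)) (allFin n)
... | yes heavy  = satisfied heavy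
... | no noHeavy = ⊥-elim (notEmpty λ T T∈F →
  notPower (withFreePoint-powerSet F T∈F
    (B (suc n) (withFreePoint F) (withFreePoint-unionClosed F closed)
       (λ U≡⊥ → ∉⊥ (subst (zero ∈_) U≡⊥ (zero∈U-withFreePoint F T∈F)))
       (withFreePoint-maxDeg F T∈F halfBounded))))
  where
  halfBounded : ∀ a → a ∈ U F → 2 * deg F a ≤ card F
  halfBounded a a∈U = ≮⇒≥ (λ heavy → noHeavy (lose (∈-allFin a) (a∈U , heavy)))

theorem5p3 : (StatementA → StatementB) × (StatementB → StatementA)
theorem5p3 = A⇒B , B⇒A
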